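{- Let $n$ be a positive integer and $\mathcal N\subseteq\mathbb Z^n$ such that (1) for some $m,m'\in\mathbb Z$ we have $\{\mathbf d:\deg(\mathbf d)\le m\}\subseteq\mathcal N\subseteq\{\mathbf d:\deg(\mathbf d)\le m'\}$, and (2) setting $M$ to be the largest degree of an element of $\mathcal N$, there exists $C$ such that for every $\mathbf d\in\mathbb Z^n$ with $\deg(\mathbf d)=M$ some $\mathbf d'\in\mathcal N$ with $\deg(\mathbf d')=M$ satisfies $\|\mathbf d-\mathbf d'\|_1\le C$. Then $f(\mathbf d)=\min_{\mathbf d'\in\mathcal N}\|\mathbf d-\mathbf d'\|_1$ is a Riemann function with offset $-M$.
   Context: $\deg(\mathbf d)=d_1+\cdots+d_n$ and $\|\cdot\|_1$ is the $L^1$ norm. A function $f\colon\mathbb Z^n\to\mathbb Z$ is a Riemann function with offset $C_0$ if for some $a,b\in\mathbb Z$, $f(\mathbf d)=0$ whenever $\deg(\mathbf d)\le a$, and $f(\mathbf d)=\deg(\mathbf d)+C_0$ whenever $\deg(\mathbf d)\ge b$. -}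

module Defs where

open import Data.Nat using (ℕ; zero; suc)
open import Data.Fin using (Fin; zero; suc)
open import Data.Integer using (ℤ; +_; _+_; _-_; _≤_; _≥_; ∣_∣)
open import Data.Product using (Σ; _×_; ∃; ∃-syntax)
open import Relation.Binary.PropositionalEquality using (_≡_)
open import Function using (_∘_)

Pt : ℕ → Set
Pt n = Fin n → ℤ

sumℤ : ∀ {n} → (Fin n → ℤ) → ℤ
sumℤ {zero}  f = + 0
sumℤ {suc n} f = f zero + sumℤ (f ∘ suc)

deg : ∀ {n} → Pt n → ℤ
deg = sumℤ

dist₁ : ∀ {n} → Pt n → Pt n → ℤ
dist₁ d d' = sumℤ (λ i → + ∣ d i - d' i ∣)

IsRiemann : ∀ {n} → (Pt n → ℤ) → ℤ → Set
IsRiemann {n} f C₀ =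
  ∃[ a ] ∃[ b ]
    ((∀ (d : Pt n) → deg d ≤ a → f d ≡ + 0) ×
     (∀ (d : Pt n) → deg d ≥ b → f d ≡ deg d + C₀))

IsMinDist : ∀ {n} → (Pt n → Set) → (Pt n → ℤ) → Set
IsMinDist {n} 𝒩 f =
  ∀ (d : Pt n) →
    (∃[ d' ] (𝒩 d' × f d ≡ dist₁ d d')) ×
    (∀ (d' : Pt n) → 𝒩 d' → f d ≤ dist₁ d d')

IsMaxDeg : ∀ {n} → (Pt n → Set) → ℤ → Set
IsMaxDeg {n} 𝒩 M =
  (∃[ d ] (𝒩 d × deg d ≡ M)) × (∀ (d : Pt n) → 𝒩 d → deg d ≤ M)

-- A point of degree at least M + nC dominates, coordinatewise, a point of 𝒩 of degree M:
-- lower it by C in every coordinate and then in one coordinate down to degree exactly M,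
-- and take the point of 𝒩 within distance C of the result. The distance to a dominated
-- point is the difference of degrees, which is also a lower bound for the distance to any
-- point of degree at most M; hence f d = deg d − M. For deg d ≤ m the point d lies in 𝒩.
module Submission where

open import Defs
open import Data.Nat using (ℕ; zero; suc; z≤n) renaming (_≤_ to _≤ℕ_)
open import Data.Fin using (Fin; zero; suc)
open import Data.Integer using (ℤ; +_; -[1+_]; 0ℤ; 1ℤ; -_; _+_; _-_; _*_; _≤_; _≥_; ∣_∣; +≤+; -≤+; nonNegative)
open import Data.Integer.Properties
  using (≤-refl; ≤-trans; ≤-antisym; +-mono-≤; +-monoˡ-≤; neg-mono-≤; +-identityˡ; +-identityʳ;
         +-inverseʳ; *-zeroˡ; *-zeroʳ; ∣i-j∣≡∣j-i∣; 0≤i⇒+∣i∣≡i; i≤j⇒0≤j-i; i-j≤i;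
         module ≤-Reasoning)
open import Data.Integer.Tactic.RingSolver using (solve-∀)
open import Data.Product using (_×_; ∃-syntax; _,_; proj₁; proj₂)
open import Function using (_∘_)
open import Relation.Binary.PropositionalEquality using (_≡_; refl; sym; trans; cong; cong₂; subst)

i≤+∣i∣ : ∀ i → i ≤ + ∣ i ∣
i≤+∣i∣ (+ _)     = ≤-refl
i≤+∣i∣ -[1+ _ ] = -≤+

i-j≤k⇒i≤j+k : ∀ {i j k} → i - j ≤ k → i ≤ j + k
i-j≤k⇒i≤j+k {i} {j} {k} i-j≤k = begin
  i           ≡⟨ reassoc i j ⟩
  (i - j) + j ≤⟨ +-monoˡ-≤ j i-j≤k ⟩
  k + j       ≡⟨ swap k j ⟩
  j + k       ∎
  where
  open ≤-Reasoning
  reassoc : ∀ i j → i ≡ (i - j) + j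
  reassoc = solve-∀
  swap : ∀ k j → k + j ≡ j + k
  swap = solve-∀

sumℤ-cong : ∀ {n} {f g : Fin n → ℤ} → (∀ i → f i ≡ g i) → sumℤ f ≡ sumℤ g
sumℤ-cong {zero}  f≡g = refl
sumℤ-cong {suc n} f≡g = cong₂ _+_ (f≡g zero) (sumℤ-cong (f≡g ∘ suc))

sumℤ-mono-≤ : ∀ {n} {f g : Fin n → ℤ} → (∀ i → f i ≤ g i) → sumℤ f ≤ sumℤ g
sumℤ-mono-≤ {zero}  f≤g = ≤-refl
sumℤ-mono-≤ {suc n} f≤g = +-mono-≤ (f≤g zero) (sumℤ-mono-≤ (f≤g ∘ suc))

sumℤ-nonneg : ∀ {n} {f : Fin n → ℤ} → (∀ i → 0ℤ ≤ f i) → 0ℤ ≤ sumℤ f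
sumℤ-nonneg {zero}  0≤f = ≤-refl
sumℤ-nonneg {suc n} 0≤f = +-mono-≤ (0≤f zero) (sumℤ-nonneg (0≤f ∘ suc))

f≤sumℤ : ∀ {n} {f : Fin n → ℤ} → (∀ i → 0ℤ ≤ f i) → ∀ i → f i ≤ sumℤ f
f≤sumℤ {suc n} {f} 0≤f zero = subst (_≤ sumℤ f) (+-identityʳ (f zero))
  (+-mono-≤ (≤-refl {f zero}) (sumℤ-nonneg (0≤f ∘ suc)))
f≤sumℤ {suc n} {f} 0≤f (suc i) = subst (_≤ sumℤ f) (+-identityˡ (f (suc i)))
  (+-mono-≤ (0≤f zero) (f≤sumℤ (0≤f ∘ suc) i))

sumℤ-minus : ∀ {n} (f g : Fin n → ℤ) → sumℤ (λ i → f i - g i) ≡ sumℤ f - sumℤ g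
sumℤ-minus {zero}  f g = refl
sumℤ-minus {suc n} f g =
  trans (cong (λ s → (f zero - g zero) + s) (sumℤ-minus (f ∘ suc) (g ∘ suc)))
        (interchange (f zero) (g zero) (sumℤ (f ∘ suc)) (sumℤ (g ∘ suc)))
  where
  interchange : ∀ a b c d → (a - b) + (c - d) ≡ (a + c) - (b + d)
  interchange = solve-∀

sumℤ-const : ∀ {n} (c : ℤ) → sumℤ {n} (λ _ → c) ≡ + n * c
sumℤ-const {zero}  c = sym (*-zeroˡ c)
sumℤ-const {suc n} c = trans (cong (λ s → c + s) (sumℤ-const {n} c)) (distrib c (+ n))
  where
  distrib : ∀ c m → c + m * c ≡ (1ℤ + m) * c
  distrib = solve-∀

dist₁-nonneg : ∀ {n} (d d' : Pt n) → 0ℤ ≤ dist₁ d d'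
dist₁-nonneg d d' = sumℤ-nonneg {f = λ i → + ∣ d i - d' i ∣} (λ _ → +≤+ z≤n)

dist₁-self : ∀ {n} (d : Pt n) → dist₁ d d ≡ 0ℤ
dist₁-self {n} d =
  trans (sumℤ-cong (λ i → cong (+_ ∘ ∣_∣) (+-inverseʳ (d i))))
        (trans (sumℤ-const {n} 0ℤ) (*-zeroʳ (+ n)))

deg-minus≤dist₁ : ∀ {n} (d d' : Pt n) → deg d - deg d' ≤ dist₁ d d'
deg-minus≤dist₁ d d' =
  subst (_≤ dist₁ d d') (sumℤ-minus d d') (sumℤ-mono-≤ (λ i → i≤+∣i∣ (d i - d' i)))

dist₁-dominated : ∀ {n} (d d' : Pt n) → (∀ i → d' i ≤ d i) → dist₁ d d' ≡ deg d - deg d'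
dist₁-dominated d d' d'≤d =
  trans (sumℤ-cong (λ i → 0≤i⇒+∣i∣≡i (i≤j⇒0≤j-i (d'≤d i)))) (sumℤ-minus d d')

dist₁≤⇒≤+ : ∀ {n} (d d' : Pt n) {C : ℤ} → dist₁ d d' ≤ C → ∀ i → d' i ≤ d i + C
dist₁≤⇒≤+ d d' {C} dist≤C i = i-j≤k⇒i≤j+k (begin
  d' i - d i       ≤⟨ i≤+∣i∣ (d' i - d i) ⟩
  + ∣ d' i - d i ∣ ≡⟨ cong +_ (∣i-j∣≡∣j-i∣ (d' i) (d i)) ⟩
  + ∣ d i - d' i ∣ ≤⟨ f≤sumℤ {f = λ j → + ∣ d j - d' j ∣} (λ _ → +≤+ z≤n) i ⟩
  dist₁ d d'       ≤⟨ dist≤C ⟩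
  C                ∎)
  where open ≤-Reasoning

deg-shift : ∀ {n} (d : Pt n) (c : ℤ) → deg (λ i → d i - c) ≡ deg d - + n * c
deg-shift {n} d c = trans (sumℤ-minus d (λ _ → c)) (cong (λ s → deg d - s) (sumℤ-const {n} c))

lowerTo : ∀ {k} → Pt (suc k) → ℤ → Pt (suc k)
lowerTo d t zero    = d zero - (deg d - t)
lowerTo d t (suc i) = d (suc i)

deg-lowerTo : ∀ {k} (d : Pt (suc k)) t → deg (lowerTo d t) ≡ t
deg-lowerTo d t = cancel (d zero) (sumℤ (d ∘ suc)) t
  where
  cancel : ∀ a s t → (a - ((a + s) - t)) + s ≡ t
  cancel = solve-∀

lowerTo-≤ : ∀ {k} (d : Pt (suc k)) {t} → t ≤ deg d → ∀ i → lowerTo d t i ≤ d i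
lowerTo-≤ d {t} t≤deg zero    = i-j≤i (d zero) (deg d - t) {{nonNegative (i≤j⇒0≤j-i t≤deg)}}
lowerTo-≤ d     t≤deg (suc i) = ≤-refl

module _ {n} {𝒩 : Pt n → Set} {f : Pt n → ℤ} (minDist : IsMinDist 𝒩 f) where

  minDist-nonneg : ∀ d → 0ℤ ≤ f d
  minDist-nonneg d with proj₁ (minDist d)
  ... | d' , _ , f≡ = subst (0ℤ ≤_) (sym f≡) (dist₁-nonneg d d')

  minDist-member : ∀ {d} → 𝒩 d → f d ≡ 0ℤ
  minDist-member {d} 𝒩d =
    ≤-antisym (subst (f d ≤_) (dist₁-self d) (proj₂ (minDist d) d 𝒩d)) (minDist-nonneg d)

  minDist-≥ : ∀ {M} → (∀ d → 𝒩 d → deg d ≤ M) → ∀ d → deg d - M ≤ f d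
  minDist-≥ {M} maxDeg d with proj₁ (minDist d)
  ... | d' , 𝒩d' , f≡ = subst (deg d - M ≤_) (sym f≡)
    (≤-trans (+-mono-≤ (≤-refl {deg d}) (neg-mono-≤ (maxDeg d' 𝒩d'))) (deg-minus≤dist₁ d d'))

  minDist-≤ : ∀ {d d'} → 𝒩 d' → (∀ i → d' i ≤ d i) → f d ≤ deg d - deg d'
  minDist-≤ {d} {d'} 𝒩d' d'≤d =
    subst (f d ≤_) (dist₁-dominated d d' d'≤d) (proj₂ (minDist d) d' 𝒩d')

dominated-member : ∀ {k} {𝒩 : Pt (suc k) → Set} {M C : ℤ} →
  (∀ (e : Pt (suc k)) → deg e ≡ M → ∃[ e' ] (𝒩 e' × deg e' ≡ M × dist₁ e e' ≤ C)) →
  ∀ d → M + + suc k * C ≤ deg d → ∃[ d' ] (𝒩 d' × deg d' ≡ M × (∀ i → d' i ≤ d i))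
dominated-member {k} {𝒩} {M} {C} near d M+nC≤deg = dominated (near e deg-e)
  where
  open ≤-Reasoning
  shifted : Pt (suc k)
  shifted i = d i - C
  e : Pt (suc k)
  e = lowerTo shifted M
  deg-e : deg e ≡ M
  deg-e = deg-lowerTo shifted M
  M≤deg-shifted : M ≤ deg shifted
  M≤deg-shifted = begin
    M                             ≡⟨ add-sub M (+ suc k * C) ⟩
    M + + suc k * C - + suc k * C ≤⟨ +-monoˡ-≤ (- (+ suc k * C)) M+nC≤deg ⟩
    deg d - + suc k * C           ≡⟨ deg-shift d C ⟨
    deg shifted                   ∎
    where
    add-sub : ∀ a b → a ≡ a + b - b
    add-sub = solve-∀
  dominated : ∃[ e' ] (𝒩 e' × deg e' ≡ M × dist₁ e e' ≤ C) →
              ∃[ d' ] (𝒩 d' × deg d' ≡ M × (∀ i → d' i ≤ d i))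
  dominated (d' , 𝒩d' , deg-d' , close) = d' , 𝒩d' , deg-d' , λ i → begin
    d' i        ≤⟨ dist₁≤⇒≤+ e d' close i ⟩
    e i + C     ≤⟨ +-monoˡ-≤ C (lowerTo-≤ shifted M≤deg-shifted i) ⟩
    d i - C + C ≡⟨ sub-add (d i) C ⟩
    d i         ∎
    where
    sub-add : ∀ a b → a - b + b ≡ a
    sub-add = solve-∀

proposition2p5 : (n : ℕ) → 1 ≤ℕ n →
    (𝒩 : Pt n → Set) →
    (m m' : ℤ) →
    (∀ (d : Pt n) → deg d ≤ m → 𝒩 d) →
    (∀ (d : Pt n) → 𝒩 d → deg d ≤ m') →
    (M : ℤ) → IsMaxDeg 𝒩 M →
    (∃[ C ] (∀ (d : Pt n) → deg d ≡ M →
    ∃[ d' ] (𝒩 d' × deg d' ≡ M × dist₁ d d' ≤ C))) →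
    (f : Pt n → ℤ) → IsMinDist 𝒩 f →
    IsRiemann f (- M)
proposition2p5 (suc k) _ 𝒩 m _ low _ M (_ , maxDeg) (C , near) f minDist =
  m , M + + suc k * C , vanishing , linear
  where
  vanishing : ∀ d → deg d ≤ m → f d ≡ + 0
  vanishing d deg≤m = minDist-member minDist (low d deg≤m)
  linear : ∀ d → deg d ≥ M + + suc k * C → f d ≡ deg d - M
  linear d deg≥ = squeeze (dominated-member near d deg≥)
    where
    squeeze : ∃[ d' ] (𝒩 d' × deg d' ≡ M × (∀ i → d' i ≤ d i)) → f d ≡ deg d - M
    squeeze (d' , 𝒩d' , deg-d' , d'≤d) = ≤-antisym
      (subst (λ x → f d ≤ deg d - x) deg-d' (minDist-≤ minDist 𝒩d' d'≤d))
      (minDist-≥ minDist maxDeg d)
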